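{- Let $\delta>0$ and $p>q>\frac{k}{n}$ (with $p,q\in(0,1)$). For every $\mathcal{F}\subseteq\binom{[n]}{k}$, \[\mathbb{E}_{(\mathbf{x},\mathbf{y})\sim D(q,p)}\Big[f_{\mathcal{F}}(\mathbf{x})\big(1-\mathrm{Cut}_\delta(f_{\mathcal{F}})(\mathbf{y})\big)\Big]\le\delta.\]
   Context: Identify $x\in\{0,1\}^n$ with $\{i:x_i=1\}$, $|x|$ its size. $f_{\mathcal{F}}(x)=0$ if $|x|<k$ and $f_{\mathcal{F}}(x)=\Pr_{\mathbf{A}\sim\binom{x}{k}}[\mathbf{A}\in\mathcal{F}]$ (uniform $k$-subset of $x$) if $|x|\ge k$. For $f:\{0,1\}^n\to\mathbb{R}$, $\mathrm{Cut}_\delta(f)(x)=1$ if $f(x)\ge\delta$ and $0$ otherwise. $D(q,p)$ is the distribution of $(\mathbf{x},\mathbf{y})$ with independent pairs $(\mathbf{x}_i,\mathbf{y}_i)$, $\mathbf{x}_i\le\mathbf{y}_i$ always, $\Pr[\mathbf{x}_i=1]=q$, $\Pr[\mathbf{y}_i=1]=p$.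
   Formalization: The parameters δ, p and q take rational rather than real values, and Cut_δ is defined only for rational-valued functions. -}

module Defs where

open import Data.Bool using (Bool; true; false; _∧_; if_then_else_; not)
open import Data.Nat using (ℕ; zero; suc; _≡ᵇ_; _<ᵇ_)
open import Data.Integer using (+_)
open import Data.List using (List; []; _∷_; map; filter; length; concatMap; foldr; _++_)
open import Data.Vec using (Vec; []; _∷_)
open import Data.Fin.Subset using (Subset; ∣_∣)
open import Data.Product using (_×_; _,_)
open import Data.Rational using (ℚ; 0ℚ; 1ℚ; _+_; _*_; _-_; _/_; _≤ᵇ_)
open import Relation.Nullary.Decidable using (does)
open import Relation.Unary using (Pred)
open import Relation.Binary.PropositionalEquality using (_≡_)

allSubsets : (n : ℕ) → List (Subset n)
allSubsets zero = [] ∷ []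
allSubsets (suc n) = map (true ∷_) (allSubsets n) ++ map (false ∷_) (allSubsets n)

_⊆ᵇ_ : {n : ℕ} → Subset n → Subset n → Bool
[] ⊆ᵇ [] = true
(true ∷ a) ⊆ᵇ (b ∷ x) = b ∧ (a ⊆ᵇ x)
(false ∷ a) ⊆ᵇ (_ ∷ x) = a ⊆ᵇ x

filterB : {A : Set} → (A → Bool) → List A → List A
filterB P [] = []
filterB P (a ∷ as) = if P a then a ∷ filterB P as else filterB P as

kSubsetsOf : {n : ℕ} → ℕ → Subset n → List (Subset n)
kSubsetsOf {n} k x = filterB (λ A → (A ⊆ᵇ x) ∧ (∣ A ∣ ≡ᵇ k)) (allSubsets n)

-- a / b as a rational (b = 0 gives 0; never used with b = 0 below)
divℕ : ℕ → ℕ → ℚ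
divℕ a zero = 0ℚ
divℕ a (suc b) = (+ a) / suc b

count : {A : Set} → (A → Bool) → List A → ℕ
count P xs = length (filterB P xs)

IsKFamily : (n k : ℕ) → (Subset n → Bool) → Set
IsKFamily n k F = (A : Subset n) → F A ≡ true → ∣ A ∣ ≡ k

fF : {n : ℕ} → ℕ → (Subset n → Bool) → Subset n → ℚ
fF k F x = if ∣ x ∣ <ᵇ k then 0ℚ
           else divℕ (count F (kSubsetsOf k x)) (length (kSubsetsOf k x))

Cut : {n : ℕ} → ℚ → (Subset n → ℚ) → Subset n → ℚ
Cut δ g y = if δ ≤ᵇ g y then 1ℚ else 0ℚ

-- per-coordinate law of (x_i, y_i) under D(q,p): x_i ≤ y_i,
-- Pr[x_i=1]=q, Pr[y_i=1]=p, so Pr(1,1)=q, Pr(0,1)=p-q, Pr(0,0)=1-p, Pr(1,0)=0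
coordProb : ℚ → ℚ → Bool → Bool → ℚ
coordProb q p true true = q
coordProb q p true false = 0ℚ
coordProb q p false true = p - q
coordProb q p false false = 1ℚ - p

probD : {n : ℕ} → ℚ → ℚ → Subset n → Subset n → ℚ
probD q p [] [] = 1ℚ
probD q p (a ∷ x) (b ∷ y) = coordProb q p a b * probD q p x y

sumℚ : List ℚ → ℚ
sumℚ = foldr _+_ 0ℚ

expectD : (n : ℕ) → ℚ → ℚ → (Subset n → Subset n → ℚ) → ℚ
expectD n q p h =
  sumℚ (concatMap (λ x → map (λ y → probD q p x y * h x y) (allSubsets n)) (allSubsets n))

{-# OPTIONS --safe #-}
module Submission where

-- Given y, the set x keeps each point of y independently with probability q/p, so
-- E[f(x) | y] ≤ f(y): if |x| ≥ k, a uniform k-subset of x is a uniform k-subset of y,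
-- and f(x) = 0 otherwise.  Where 1 − Cut_δ(f)(y) ≠ 0 we have f(y) < δ, hence the
-- expectation is at most δ.  To avoid conditioning, the first inequality is proved as
-- Σₓ Pr[x, y] f(x) ≤ Pr[y] f(y) by double counting pairs (A, x) with A ⊆ x a k-set:
-- Σ_{x ⊇ A} Pr[x, y] / C(|x|, k) is the same number γ(y) for every k-subset A of y, so
-- the left side is #(F ∩ binom(y, k)) · γ(y), and for F = binom([n], k) it gives
-- C(|y|, k) · γ(y) ≤ Pr[y].

open import Defs
open import Data.Nat using (ℕ)
open import Data.Integer using (+_)
open import Data.Fin.Subset using (Subset)
open import Data.Bool using (Bool)
open import Data.Rational using (ℚ; 0ℚ; 1ℚ; _<_; _≤_; _*_; _-_; _/_)

open import Data.Nat as ℕ using (zero; suc; _≡ᵇ_; _<ᵇ_; _∸_)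
import Data.Nat.Properties as ℕ
open import Data.Nat.Combinatorics using (_C_; k>n⇒nCk≡0; nCk+nC[k+1]≡[n+1]C[k+1])
import Data.Integer as ℤ
import Data.Integer.Properties as ℤ
open import Data.Bool using (true; false; _∧_; if_then_else_; T)
open import Data.Bool.Properties using (∧-assoc; ∧-identityʳ; ∧-zeroʳ)
open import Data.List using (List; []; _∷_; map; _++_; concatMap; length)
open import Data.List.Properties using (map-++; map-cong; map-∘)
open import Data.Vec using ([]; _∷_)
open import Data.Fin.Subset using (∣_∣; _─_)
open import Data.Rational using (_+_; -_; _≤ᵇ_; fromℚᵘ; nonNegative; +-*-rawSemiring)
open import Data.Rational.Properties
  using (+-identityˡ; +-identityʳ; +-assoc; +-inverseʳ; *-comm; *-zeroˡ; *-zeroʳ; *-identityˡ; *-identityʳ;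
         *-distribˡ-+; *-distribʳ-+; ≤-refl; ≤-reflexive; ≤-trans; ≤-antisym; <⇒≤; ≰⇒>; ≤ᵇ⇒≤; ≤⇒≤ᵇ;
         +-mono-≤; +-monoˡ-≤; *-monoˡ-≤-nonNeg; nonNegative⁻¹; nonNeg*nonNeg⇒nonNeg; normalize-nonNeg;
         toℚᵘ-injective; toℚᵘ-fromℚᵘ; toℚᵘ-homo-+; fromℚᵘ-cong; module ≤-Reasoning)
import Data.Rational.Unnormalised as ℚᵘ
import Data.Rational.Unnormalised.Properties as ℚᵘ
open import Data.Rational.Solver using (module +-*-Solver)
open import Algebra.Definitions.RawSemiring +-*-rawSemiring using (_×_; _^_)
open import Function using (_∘_)
open import Relation.Binary.PropositionalEquality using (_≡_; refl; sym; trans; cong; cong₂; subst; module ≡-Reasoning)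

open +-*-Solver using (solve; _:=_; _:+_; _:*_; _:-_; con)

private variable
  I J : Set
  n : ℕ

sumOver : (I → ℚ) → List I → ℚ
sumOver g xs = sumℚ (map g xs)

sumℚ-++ : (xs ys : List ℚ) → sumℚ (xs ++ ys) ≡ sumℚ xs + sumℚ ys
sumℚ-++ []       ys = sym (+-identityˡ _)
sumℚ-++ (x ∷ xs) ys = trans (cong (_+_ x) (sumℚ-++ xs ys)) (sym (+-assoc x _ _))

sumℚ-concatMap : (f : I → List ℚ) (xs : List I) → sumℚ (concatMap f xs) ≡ sumOver (sumℚ ∘ f) xs
sumℚ-concatMap f []       = refl
sumℚ-concatMap f (x ∷ xs) = trans (sumℚ-++ (f x) _) (cong (_+_ (sumℚ (f x))) (sumℚ-concatMap f xs))

sumOver-++ : (g : I → ℚ) (xs ys : List I) → sumOver g (xs ++ ys) ≡ sumOver g xs + sumOver g ys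
sumOver-++ g xs ys = trans (cong sumℚ (map-++ g xs ys)) (sumℚ-++ (map g xs) (map g ys))

sumOver-map : (g : J → ℚ) (h : I → J) (xs : List I) → sumOver g (map h xs) ≡ sumOver (g ∘ h) xs
sumOver-map g h xs = cong sumℚ (sym (map-∘ xs))

sumOver-cong : {g h : I → ℚ} → (∀ x → g x ≡ h x) → (xs : List I) → sumOver g xs ≡ sumOver h xs
sumOver-cong g≗h xs = cong sumℚ (map-cong g≗h xs)

sumOver-zero : (xs : List I) → sumOver (λ _ → 0ℚ) xs ≡ 0ℚ
sumOver-zero []       = refl
sumOver-zero (x ∷ xs) = trans (+-identityˡ _) (sumOver-zero xs)

sumOver-+ : (g h : I → ℚ) (xs : List I) → sumOver (λ x → g x + h x) xs ≡ sumOver g xs + sumOver h xs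
sumOver-+ g h []       = refl
sumOver-+ g h (x ∷ xs) = trans (cong (_+_ (g x + h x)) (sumOver-+ g h xs))
  (solve 4 (λ a b c d → (a :+ b) :+ (c :+ d) := (a :+ c) :+ (b :+ d)) refl (g x) (h x) _ _)

sumOver-*ˡ : (c : ℚ) (g : I → ℚ) (xs : List I) → sumOver (λ x → c * g x) xs ≡ c * sumOver g xs
sumOver-*ˡ c g []       = sym (*-zeroʳ c)
sumOver-*ˡ c g (x ∷ xs) = trans (cong (_+_ (c * g x)) (sumOver-*ˡ c g xs)) (sym (*-distribˡ-+ c (g x) _))

sumOver-*ʳ : (c : ℚ) (g : I → ℚ) (xs : List I) → sumOver (λ x → g x * c) xs ≡ sumOver g xs * c
sumOver-*ʳ c g xs = trans (sumOver-cong (λ x → *-comm (g x) c) xs) (trans (sumOver-*ˡ c g xs) (*-comm c _))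

sumOver-*-inner : (c : ℚ) (ι P χ : I → ℚ) (xs : List I) →
  sumOver (λ x → ι x * ((c * P x) * χ x)) xs ≡ c * sumOver (λ x → ι x * (P x * χ x)) xs
sumOver-*-inner c ι P χ xs = trans
  (sumOver-cong (λ x → solve 4 (λ i c P χ → i :* ((c :* P) :* χ) := c :* (i :* (P :* χ))) refl (ι x) c (P x) (χ x)) xs)
  (sumOver-*ˡ c (λ x → ι x * (P x * χ x)) xs)

sumOver-comm : (g : I → J → ℚ) (xs : List I) (ys : List J) →
  sumOver (λ x → sumOver (g x) ys) xs ≡ sumOver (λ y → sumOver (λ x → g x y) xs) ys
sumOver-comm g []       ys = sym (sumOver-zero ys)
sumOver-comm g (x ∷ xs) ys = trans (cong (_+_ (sumOver (g x) ys)) (sumOver-comm g xs ys))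
  (sym (sumOver-+ (g x) (λ y → sumOver (λ x → g x y) xs) ys))

sumOver-mono : {g h : I → ℚ} → (∀ x → g x ≤ h x) → (xs : List I) → sumOver g xs ≤ sumOver h xs
sumOver-mono g≤h []       = ≤-refl
sumOver-mono g≤h (x ∷ xs) = +-mono-≤ (g≤h x) (sumOver-mono g≤h xs)

sumOver-nonneg : {g : I → ℚ} → (∀ x → 0ℚ ≤ g x) → (xs : List I) → 0ℚ ≤ sumOver g xs
sumOver-nonneg {g = g} 0≤g xs = subst (_≤ sumOver g xs) (sumOver-zero xs) (sumOver-mono 0≤g xs)

Σₛ : (Subset n → ℚ) → ℚ
Σₛ {n} g = sumOver g (allSubsets n)

Σₛ-cons : (g : Subset (suc n) → ℚ) → Σₛ g ≡ Σₛ (g ∘ (true ∷_)) + Σₛ (g ∘ (false ∷_))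
Σₛ-cons {n} g = trans (sumOver-++ g (map (true ∷_) (allSubsets n)) _)
  (cong₂ _+_ (sumOver-map g (true ∷_) (allSubsets n)) (sumOver-map g (false ∷_) (allSubsets n)))

⟦_⟧ : Bool → ℚ
⟦ b ⟧ = if b then 1ℚ else 0ℚ

⟦⟧-nonneg : (b : Bool) → 0ℚ ≤ ⟦ b ⟧
⟦⟧-nonneg true  = ≤ᵇ⇒≤ _
⟦⟧-nonneg false = ≤-refl

⟦∧⟧≤⟦⟧ : (a b : Bool) → ⟦ a ∧ b ⟧ ≤ ⟦ a ⟧
⟦∧⟧≤⟦⟧ false b     = ≤-refl
⟦∧⟧≤⟦⟧ true  true  = ≤-refl
⟦∧⟧≤⟦⟧ true  false = ⟦⟧-nonneg true

⟦∧⟧ : (a b : Bool) → ⟦ a ∧ b ⟧ ≡ ⟦ a ⟧ * ⟦ b ⟧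
⟦∧⟧ true  b = sym (*-identityˡ ⟦ b ⟧)
⟦∧⟧ false b = sym (*-zeroˡ ⟦ b ⟧)

0ℚ*≡0ℚ* : (a b : ℚ) → 0ℚ * a ≡ 0ℚ * b
0ℚ*≡0ℚ* a b = trans (*-zeroˡ a) (sym (*-zeroˡ b))

*-nonneg : {a b : ℚ} → 0ℚ ≤ a → 0ℚ ≤ b → 0ℚ ≤ a * b
*-nonneg {a} {b} 0≤a 0≤b =
  nonNegative⁻¹ _ {{nonNeg*nonNeg⇒nonNeg a {{nonNegative 0≤a}} b {{nonNegative 0≤b}}}}

*-monoˡ-≤-nonneg : {r a b : ℚ} → 0ℚ ≤ r → a ≤ b → r * a ≤ r * b
*-monoˡ-≤-nonneg {r} 0≤r = *-monoˡ-≤-nonNeg r {{nonNegative 0≤r}}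

p≤q⇒0≤q-p : {p q : ℚ} → p ≤ q → 0ℚ ≤ q - p
p≤q⇒0≤q-p {p} {q} p≤q = subst (_≤ q - p) (+-inverseʳ p) (+-monoˡ-≤ (- p) p≤q)

count-as-sum : (P : I → Bool) (xs : List I) → count P xs × 1ℚ ≡ sumOver (⟦_⟧ ∘ P) xs
count-as-sum P []       = refl
count-as-sum P (x ∷ xs) with P x
... | true  = cong (_+_ 1ℚ) (count-as-sum P xs)
... | false = trans (count-as-sum P xs) (sym (+-identityˡ _))

count-filterB : (P Q : I → Bool) (xs : List I) → count Q (filterB P xs) ≡ count (λ x → P x ∧ Q x) xs
count-filterB P Q []       = refl
count-filterB P Q (x ∷ xs) with P x
... | false = count-filterB P Q xs
... | true with Q x
...   | true  = cong suc (count-filterB P Q xs)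
...   | false = count-filterB P Q xs

count-++ : (P : I → Bool) (xs ys : List I) → count P (xs ++ ys) ≡ count P xs ℕ.+ count P ys
count-++ P []       ys = refl
count-++ P (x ∷ xs) ys with P x
... | true  = cong suc (count-++ P xs ys)
... | false = count-++ P xs ys

count-map : (P : J → Bool) (h : I → J) (xs : List I) → count P (map h xs) ≡ count (P ∘ h) xs
count-map P h []       = refl
count-map P h (x ∷ xs) with P (h x)
... | true  = cong suc (count-map P h xs)
... | false = count-map P h xs

count-cong : {P Q : I → Bool} → (∀ x → P x ≡ Q x) → (xs : List I) → count P xs ≡ count Q xs
count-cong P≗Q []       = refl
count-cong {Q = Q} P≗Q (x ∷ xs) rewrite P≗Q x with Q x
... | true  = cong suc (count-cong P≗Q xs)
... | false = count-cong P≗Q xs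

count-false : (xs : List I) → count (λ _ → false) xs ≡ 0
count-false []       = refl
count-false (x ∷ xs) = count-false xs

count-allSubsets-cons : (P : Subset (suc n) → Bool) →
  count P (allSubsets (suc n)) ≡ count (P ∘ (true ∷_)) (allSubsets n) ℕ.+ count (P ∘ (false ∷_)) (allSubsets n)
count-allSubsets-cons {n} P = trans (count-++ P (map (true ∷_) (allSubsets n)) _)
  (cong₂ ℕ._+_ (count-map P (true ∷_) (allSubsets n)) (count-map P (false ∷_) (allSubsets n)))

fromℚᵘ-homo-+ : (u v : ℚᵘ.ℚᵘ) → fromℚᵘ (u ℚᵘ.+ v) ≡ fromℚᵘ u + fromℚᵘ v
fromℚᵘ-homo-+ u v = toℚᵘ-injective (ℚᵘ.≃-trans (toℚᵘ-fromℚᵘ (u ℚᵘ.+ v))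
  (ℚᵘ.≃-trans (ℚᵘ.+-cong (ℚᵘ.≃-sym (toℚᵘ-fromℚᵘ u)) (ℚᵘ.≃-sym (toℚᵘ-fromℚᵘ v)))
    (ℚᵘ.≃-sym (toℚᵘ-homo-+ (fromℚᵘ u) (fromℚᵘ v)))))

divℕ-zero : (m : ℕ) → divℕ 0 m ≡ 0ℚ
divℕ-zero zero    = refl
divℕ-zero (suc b) = fromℚᵘ-cong {ℚᵘ.mkℚᵘ (+ 0) b} {ℚᵘ.mkℚᵘ (+ 0) 0} (ℚᵘ.*≡* refl)

divℕ-suc : (a m : ℕ) → divℕ (suc a) m ≡ divℕ 1 m + divℕ a m
divℕ-suc a zero    = refl
divℕ-suc a (suc b) = trans (fromℚᵘ-cong split) (fromℚᵘ-homo-+ (ℚᵘ.mkℚᵘ (+ 1) b) (ℚᵘ.mkℚᵘ (+ a) b))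
  where
  d : ℤ.ℤ
  d = + suc b
  split : ℚᵘ.mkℚᵘ (+ suc a) b ℚᵘ.≃ ℚᵘ.mkℚᵘ (+ 1) b ℚᵘ.+ ℚᵘ.mkℚᵘ (+ a) b
  split = ℚᵘ.*≡* (begin
    + suc a ℤ.* + (suc b ℕ.* suc b)  ≡⟨ cong₂ ℤ._*_ (ℤ.pos-+ 1 a) (ℤ.pos-* (suc b) (suc b)) ⟩
    (+ 1 ℤ.+ + a) ℤ.* (d ℤ.* d)      ≡⟨ ℤ.*-assoc (+ 1 ℤ.+ + a) d d ⟨
    (+ 1 ℤ.+ + a) ℤ.* d ℤ.* d        ≡⟨ cong (ℤ._* d) (ℤ.*-distribʳ-+ d (+ 1) (+ a)) ⟩
    (+ 1 ℤ.* d ℤ.+ + a ℤ.* d) ℤ.* d  ∎)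
    where open ≡-Reasoning

divℕ-as-product : (a m : ℕ) → divℕ a m ≡ (a × 1ℚ) * divℕ 1 m
divℕ-as-product zero    m = trans (divℕ-zero m) (sym (*-zeroˡ (divℕ 1 m)))
divℕ-as-product (suc a) m = trans (divℕ-suc a m)
  (trans (cong (_+_ (divℕ 1 m)) (divℕ-as-product a m))
    (solve 2 (λ d x → d :+ x :* d := (con 1ℚ :+ x) :* d) refl (divℕ 1 m) (a × 1ℚ)))

divℕ-self : (b : ℕ) → divℕ (suc b) (suc b) ≡ 1ℚ
divℕ-self b = fromℚᵘ-cong {ℚᵘ.mkℚᵘ (+ suc b) b} {ℚᵘ.mkℚᵘ (+ 1) 0} (ℚᵘ.*≡* (ℤ.*-comm (+ suc b) (+ 1)))

divℕ-nonneg : (a m : ℕ) → 0ℚ ≤ divℕ a m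
divℕ-nonneg a zero    = ≤-refl
divℕ-nonneg a (suc b) = nonNegative⁻¹ _ {{normalize-nonNeg a (suc b)}}

×-divℕ≤1 : (m : ℕ) → (m × 1ℚ) * divℕ 1 m ≤ 1ℚ
×-divℕ≤1 zero    = ≤ᵇ⇒≤ _
×-divℕ≤1 (suc b) = ≤-reflexive (trans (sym (divℕ-as-product (suc b) (suc b))) (divℕ-self b))

proportional-≤ : (m : ℕ) {N c P : ℚ} → 0ℚ ≤ N → N ≤ m × 1ℚ → (m × 1ℚ) * c ≤ P → N * c ≤ P * (N * divℕ 1 m)
proportional-≤ zero {N} {c} {P} 0≤N N≤0 _ = ≤-reflexive (begin
  N * c            ≡⟨ cong (_* c) N≡0 ⟩
  0ℚ * c           ≡⟨ 0ℚ*≡0ℚ* c (P * 0ℚ) ⟩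
  0ℚ * (P * 0ℚ)    ≡⟨ solve 1 (λ P → con 0ℚ :* (P :* con 0ℚ) := P :* (con 0ℚ :* con 0ℚ)) refl P ⟩
  P * (0ℚ * 0ℚ)    ≡⟨ cong (λ t → P * (t * 0ℚ)) N≡0 ⟨
  P * (N * 0ℚ)     ∎)
  where
  open ≡-Reasoning
  N≡0 : N ≡ 0ℚ
  N≡0 = ≤-antisym N≤0 0≤N
proportional-≤ (suc b) {N} {c} {P} 0≤N _ mc≤P = begin
  N * c              ≡⟨ cong (N *_) cancel ⟨
  N * (ι * (m * c))  ≤⟨ *-monoˡ-≤-nonneg 0≤N (*-monoˡ-≤-nonneg (divℕ-nonneg 1 (suc b)) mc≤P) ⟩
  N * (ι * P)        ≡⟨ solve 3 (λ N ι P → N :* (ι :* P) := P :* (N :* ι)) refl N ι P ⟩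
  P * (N * ι)        ∎
  where
  open ≤-Reasoning
  m : ℚ
  m = suc b × 1ℚ
  ι : ℚ
  ι = divℕ 1 (suc b)
  cancel : ι * (m * c) ≡ c
  cancel = trans (solve 3 (λ ι m c → ι :* (m :* c) := (m :* ι) :* c) refl ι m c)
    (trans (cong (_* c) (trans (sym (divℕ-as-product (suc b) (suc b))) (divℕ-self b))) (*-identityˡ c))

∣y─A∣+∣A∣≡∣y∣ : (A y : Subset n) → A ⊆ᵇ y ≡ true → ∣ y ─ A ∣ ℕ.+ ∣ A ∣ ≡ ∣ y ∣
∣y─A∣+∣A∣≡∣y∣ []          []          _ = refl
∣y─A∣+∣A∣≡∣y∣ (false ∷ A) (true ∷ y)  h = cong suc (∣y─A∣+∣A∣≡∣y∣ A y h)
∣y─A∣+∣A∣≡∣y∣ (false ∷ A) (false ∷ y) h = ∣y─A∣+∣A∣≡∣y∣ A y h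
∣y─A∣+∣A∣≡∣y∣ (true ∷ A)  (true ∷ y)  h = trans (ℕ.+-suc ∣ y ─ A ∣ ∣ A ∣) (cong suc (∣y─A∣+∣A∣≡∣y∣ A y h))

isKSubset : ℕ → Subset n → Subset n → Bool
isKSubset k x A = (A ⊆ᵇ x) ∧ (∣ A ∣ ≡ᵇ k)

kSubsetsOf-length : (k : ℕ) (x : Subset n) → length (kSubsetsOf k x) ≡ ∣ x ∣ C k
kSubsetsOf-length zero    [] = refl
kSubsetsOf-length (suc k) [] = refl
kSubsetsOf-length {suc n} k (false ∷ x) =
  trans (count-allSubsets-cons (isKSubset k (false ∷ x)))
    (trans (cong (ℕ._+ length (kSubsetsOf k x)) (count-false (allSubsets n))) (kSubsetsOf-length k x))
kSubsetsOf-length {suc n} zero (true ∷ x) =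
  trans (count-allSubsets-cons (isKSubset zero (true ∷ x)))
    (trans (cong (ℕ._+ length (kSubsetsOf zero x))
                 (trans (count-cong (λ A → ∧-zeroʳ (A ⊆ᵇ x)) (allSubsets n)) (count-false (allSubsets n))))
      (kSubsetsOf-length zero x))
kSubsetsOf-length (suc k) (true ∷ x) =
  trans (count-allSubsets-cons (isKSubset (suc k) (true ∷ x)))
    (trans (cong₂ ℕ._+_ (kSubsetsOf-length k x) (kSubsetsOf-length (suc k) x))
      (nCk+nC[k+1]≡[n+1]C[k+1] ∣ x ∣ k))

sum-isKSubset : (k : ℕ) (x : Subset n) → Σₛ (λ A → ⟦ isKSubset k x A ⟧) ≡ (∣ x ∣ C k) × 1ℚ
sum-isKSubset {n} k x =
  trans (sym (count-as-sum (isKSubset k x) (allSubsets n))) (cong (_× 1ℚ) (kSubsetsOf-length k x))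

kCount : ℕ → (Subset n → Bool) → Subset n → ℚ
kCount k G x = Σₛ λ A → ⟦ isKSubset k x A ∧ G A ⟧

kCount-all : (k : ℕ) (x : Subset n) → kCount k (λ _ → true) x ≡ (∣ x ∣ C k) × 1ℚ
kCount-all {n} k x =
  trans (sumOver-cong (λ A → cong ⟦_⟧ (∧-identityʳ (isKSubset k x A))) (allSubsets n)) (sum-isKSubset k x)

kCount≤binomial : (k : ℕ) (G : Subset n → Bool) (x : Subset n) → kCount k G x ≤ (∣ x ∣ C k) × 1ℚ
kCount≤binomial {n} k G x = ≤-trans (sumOver-mono (λ A → ⟦∧⟧≤⟦⟧ (isKSubset k x A) (G A)) (allSubsets n))
  (≤-reflexive (sum-isKSubset k x))

kCount-nonneg : (k : ℕ) (G : Subset n → Bool) (x : Subset n) → 0ℚ ≤ kCount k G x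
kCount-nonneg {n} k G x = sumOver-nonneg (λ A → ⟦⟧-nonneg (isKSubset k x A ∧ G A)) (allSubsets n)

fF-as-divℕ : (k : ℕ) (F : Subset n → Bool) (x : Subset n) →
  fF k F x ≡ divℕ (count F (kSubsetsOf k x)) (∣ x ∣ C k)
fF-as-divℕ k F x with ∣ x ∣ <ᵇ k in <ᵇk
... | true  = sym (cong (divℕ _) (k>n⇒nCk≡0 (ℕ.<ᵇ⇒< ∣ x ∣ k (subst T (sym <ᵇk) _))))
... | false = cong (divℕ _) (kSubsetsOf-length k x)

fF-as-kCount : (k : ℕ) (F : Subset n → Bool) (x : Subset n) →
  fF k F x ≡ kCount k F x * divℕ 1 (∣ x ∣ C k)
fF-as-kCount {n} k F x = trans (fF-as-divℕ k F x)
  (trans (divℕ-as-product (count F (kSubsetsOf k x)) (∣ x ∣ C k))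
    (cong (_* divℕ 1 (∣ x ∣ C k))
      (trans (cong (_× 1ℚ) (count-filterB (isKSubset k x) F (allSubsets n)))
        (count-as-sum (λ A → isKSubset k x A ∧ F A) (allSubsets n)))))

module _ (q p : ℚ) where

  -- binomialSum e φ = Σⱼ C(e, j) qʲ (p − q)^(e − j) φ(j)
  binomialSum : ℕ → (ℕ → ℚ) → ℚ
  binomialSum zero    φ = φ 0
  binomialSum (suc e) φ = q * binomialSum e (φ ∘ suc) + (p - q) * binomialSum e φ

  binomialSum-cong : (e : ℕ) {φ χ : ℕ → ℚ} → (∀ j → φ j ≡ χ j) → binomialSum e φ ≡ binomialSum e χ
  binomialSum-cong zero    φ≗χ = φ≗χ 0
  binomialSum-cong (suc e) φ≗χ =
    cong₂ (λ u v → q * u + (p - q) * v) (binomialSum-cong e (φ≗χ ∘ suc)) (binomialSum-cong e φ≗χ)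

  absentWeight : Subset n → ℚ
  absentWeight []          = 1ℚ
  absentWeight (true ∷ y)  = absentWeight y
  absentWeight (false ∷ y) = (1ℚ - p) * absentWeight y

  upperSum : Subset n → Subset n → (ℕ → ℚ) → ℚ
  upperSum A y φ = Σₛ λ x → ⟦ A ⊆ᵇ x ⟧ * (probD q p x y * φ ∣ x ∣)

  closedForm : Subset n → ℕ → ℕ → (ℕ → ℚ) → ℚ
  closedForm y a e φ = absentWeight y * (q ^ a * binomialSum e (λ j → φ (a ℕ.+ j)))

  upperSum-true∷ : (A y : Subset n) (b : Bool) (φ : ℕ → ℚ) →
    upperSum (true ∷ A) (b ∷ y) φ ≡ coordProb q p true b * upperSum A y (φ ∘ suc)
  upperSum-true∷ {n} A y b φ = begin
    upperSum (true ∷ A) (b ∷ y) φ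
      ≡⟨ Σₛ-cons (λ x → ⟦ (true ∷ A) ⊆ᵇ x ⟧ * (probD q p x (b ∷ y) * φ ∣ x ∣)) ⟩
    Σₛ (λ x → ⟦ A ⊆ᵇ x ⟧ * ((c * probD q p x y) * φ (suc ∣ x ∣))) + Σₛ (λ x → 0ℚ * r x)
      ≡⟨ cong₂ _+_ (sumOver-*-inner c (λ x → ⟦ A ⊆ᵇ x ⟧) (λ x → probD q p x y) (φ ∘ suc ∘ ∣_∣) (allSubsets n))
                   (trans (sumOver-*ˡ 0ℚ r (allSubsets n)) (*-zeroˡ (Σₛ r))) ⟩
    c * upperSum A y (φ ∘ suc) + 0ℚ
      ≡⟨ +-identityʳ _ ⟩
    c * upperSum A y (φ ∘ suc) ∎
    where
    open ≡-Reasoning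
    c : ℚ
    c = coordProb q p true b
    r : Subset n → ℚ
    r x = coordProb q p false b * probD q p x y * φ ∣ x ∣

  upperSum-false∷ : (A y : Subset n) (b : Bool) (φ : ℕ → ℚ) →
    upperSum (false ∷ A) (b ∷ y) φ ≡
      coordProb q p true b * upperSum A y (φ ∘ suc) + coordProb q p false b * upperSum A y φ
  upperSum-false∷ {n} A y b φ =
    trans (Σₛ-cons (λ x → ⟦ (false ∷ A) ⊆ᵇ x ⟧ * (probD q p x (b ∷ y) * φ ∣ x ∣))) (cong₂ _+_
    (sumOver-*-inner (coordProb q p true b) (λ x → ⟦ A ⊆ᵇ x ⟧) (λ x → probD q p x y) (φ ∘ suc ∘ ∣_∣) (allSubsets n))
    (sumOver-*-inner (coordProb q p false b) (λ x → ⟦ A ⊆ᵇ x ⟧) (λ x → probD q p x y) (φ ∘ ∣_∣) (allSubsets n)))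

  -- Given y, a point of A must lie in x (weight q), a point of y ∖ A is in x or not
  -- (weights q and p − q), and a point outside y is in neither (weight 1 − p).
  upperSum-closedForm : (A y : Subset n) (φ : ℕ → ℚ) →
    upperSum A y φ ≡ ⟦ A ⊆ᵇ y ⟧ * closedForm y ∣ A ∣ ∣ y ─ A ∣ φ
  upperSum-closedForm [] [] φ =
    solve 1 (λ f → con 1ℚ :* (con 1ℚ :* f) :+ con 0ℚ := con 1ℚ :* (con 1ℚ :* (con 1ℚ :* f))) refl (φ 0)
  upperSum-closedForm (true ∷ A) (true ∷ y) φ =
    trans (upperSum-true∷ A y true φ) (trans (cong (q *_) (upperSum-closedForm A y (φ ∘ suc)))
      (solve 5 (λ q i z w t → q :* (i :* (z :* (w :* t))) := i :* (z :* ((q :* w) :* t))) refl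
        q ⟦ A ⊆ᵇ y ⟧ (absentWeight y) (q ^ ∣ A ∣) (binomialSum ∣ y ─ A ∣ (λ j → φ (suc (∣ A ∣ ℕ.+ j))))))
  upperSum-closedForm (true ∷ A) (false ∷ y) φ =
    trans (upperSum-true∷ A y false φ)
      (trans (*-zeroˡ (upperSum A y (φ ∘ suc))) (sym (*-zeroˡ (closedForm (false ∷ y) (suc ∣ A ∣) ∣ y ─ A ∣ φ))))
  upperSum-closedForm (false ∷ A) (true ∷ y) φ =
    trans (upperSum-false∷ A y true φ)
      (trans (cong₂ (λ u v → q * u + (p - q) * v) (upperSum-closedForm A y (φ ∘ suc)) (upperSum-closedForm A y φ))
        (trans (cong (λ t′ → q * (i * (z * (w * t′))) + (p - q) * (i * (z * (w * t))))
                     (binomialSum-cong ∣ y ─ A ∣ (λ j → cong φ (sym (ℕ.+-suc ∣ A ∣ j)))))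
          (solve 7 (λ q r i z w t′ t → q :* (i :* (z :* (w :* t′))) :+ r :* (i :* (z :* (w :* t)))
                                         := i :* (z :* (w :* (q :* t′ :+ r :* t)))) refl
            q (p - q) i z w (binomialSum ∣ y ─ A ∣ (λ j → φ (∣ A ∣ ℕ.+ suc j))) t)))
    where
    i z w t : ℚ
    i = ⟦ A ⊆ᵇ y ⟧
    z = absentWeight y
    w = q ^ ∣ A ∣
    t = binomialSum ∣ y ─ A ∣ (λ j → φ (∣ A ∣ ℕ.+ j))
  upperSum-closedForm (false ∷ A) (false ∷ y) φ =
    trans (upperSum-false∷ A y false φ)
      (trans (cong (λ v → 0ℚ * upperSum A y (φ ∘ suc) + (1ℚ - p) * v) (upperSum-closedForm A y φ))
        (solve 6 (λ u r i z w t → con 0ℚ :* u :+ r :* (i :* (z :* (w :* t))) := i :* ((r :* z) :* (w :* t))) refl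
          (upperSum A y (φ ∘ suc)) (1ℚ - p) ⟦ A ⊆ᵇ y ⟧ (absentWeight y) (q ^ ∣ A ∣)
          (binomialSum ∣ y ─ A ∣ (λ j → φ (∣ A ∣ ℕ.+ j)))))

  upperSum-⊈ : (A y : Subset n) (φ : ℕ → ℚ) → A ⊆ᵇ y ≡ false → upperSum A y φ ≡ 0ℚ
  upperSum-⊈ A y φ A⊈y = trans (upperSum-closedForm A y φ)
    (trans (cong (λ b → ⟦ b ⟧ * closedForm y ∣ A ∣ ∣ y ─ A ∣ φ) A⊈y) (*-zeroˡ (closedForm y ∣ A ∣ ∣ y ─ A ∣ φ)))

  upperSum-kSubset : {k : ℕ} (A y : Subset n) (φ : ℕ → ℚ) → A ⊆ᵇ y ≡ true → ∣ A ∣ ≡ k →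
    upperSum A y φ ≡ closedForm y k (∣ y ∣ ∸ k) φ
  upperSum-kSubset {k = k} A y φ A⊆y ∣A∣≡k = trans (upperSum-closedForm A y φ)
    (trans (cong (λ b → ⟦ b ⟧ * closedForm y ∣ A ∣ ∣ y ─ A ∣ φ) A⊆y)
      (trans (*-identityˡ (closedForm y ∣ A ∣ ∣ y ─ A ∣ φ)) (cong₂ (λ a e → closedForm y a e φ) ∣A∣≡k ∣y─A∣≡∣y∣∸k)))
    where
    ∣y─A∣≡∣y∣∸k : ∣ y ─ A ∣ ≡ ∣ y ∣ ∸ k
    ∣y─A∣≡∣y∣∸k = trans (sym (ℕ.m+n∸n≡m ∣ y ─ A ∣ ∣ A ∣)) (cong₂ _∸_ (∣y─A∣+∣A∣≡∣y∣ A y A⊆y) ∣A∣≡k)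

  upperSum-weighted : (k : ℕ) (G : Subset n → Bool) (y A : Subset n) (φ : ℕ → ℚ) →
    ⟦ (∣ A ∣ ≡ᵇ k) ∧ G A ⟧ * upperSum A y φ ≡
      ⟦ ((A ⊆ᵇ y) ∧ (∣ A ∣ ≡ᵇ k)) ∧ G A ⟧ * closedForm y k (∣ y ∣ ∸ k) φ
  upperSum-weighted k G y A φ with A ⊆ᵇ y in A⊆y | ∣ A ∣ ≡ᵇ k in ∣A∣≡ᵇk | G A
  ... | true  | true  | true  = trans (*-identityˡ (upperSum A y φ))
    (trans (upperSum-kSubset A y φ A⊆y (ℕ.≡ᵇ⇒≡ ∣ A ∣ k (subst T (sym ∣A∣≡ᵇk) _)))
      (sym (*-identityˡ (closedForm y k (∣ y ∣ ∸ k) φ))))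
  ... | false | true  | true  = trans (*-identityˡ (upperSum A y φ))
    (trans (upperSum-⊈ A y φ A⊆y) (sym (*-zeroˡ (closedForm y k (∣ y ∣ ∸ k) φ))))
  ... | true  | true  | false = 0ℚ*≡0ℚ* (upperSum A y φ) (closedForm y k (∣ y ∣ ∸ k) φ)
  ... | false | true  | false = 0ℚ*≡0ℚ* (upperSum A y φ) (closedForm y k (∣ y ∣ ∸ k) φ)
  ... | true  | false | _     = 0ℚ*≡0ℚ* (upperSum A y φ) (closedForm y k (∣ y ∣ ∸ k) φ)
  ... | false | false | _     = 0ℚ*≡0ℚ* (upperSum A y φ) (closedForm y k (∣ y ∣ ∸ k) φ)

  kCount-doubleCount : (k : ℕ) (G : Subset n → Bool) (y : Subset n) (φ : ℕ → ℚ) →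
    Σₛ (λ x → probD q p x y * (kCount k G x * φ ∣ x ∣)) ≡ kCount k G y * closedForm y k (∣ y ∣ ∸ k) φ
  kCount-doubleCount {n} k G y φ = begin
    Σₛ (λ x → probD q p x y * (kCount k G x * φ ∣ x ∣))
      ≡⟨ sumOver-cong expand (allSubsets n) ⟩
    Σₛ (λ x → Σₛ λ A → term A x)
      ≡⟨ sumOver-comm (λ x A → term A x) (allSubsets n) (allSubsets n) ⟩
    Σₛ (λ A → Σₛ λ x → term A x)
      ≡⟨ sumOver-cong (λ A → trans (sumOver-*ˡ ⟦ w A ⟧ (λ x → ⟦ A ⊆ᵇ x ⟧ * (probD q p x y * φ ∣ x ∣)) (allSubsets n))
                                    (upperSum-weighted k G y A φ)) (allSubsets n) ⟩
    Σₛ (λ A → ⟦ isKSubset k y A ∧ G A ⟧ * c)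
      ≡⟨ sumOver-*ʳ c (λ A → ⟦ isKSubset k y A ∧ G A ⟧) (allSubsets n) ⟩
    kCount k G y * c ∎
    where
    open ≡-Reasoning
    c : ℚ
    c = closedForm y k (∣ y ∣ ∸ k) φ
    w : Subset n → Bool
    w A = (∣ A ∣ ≡ᵇ k) ∧ G A
    term : Subset n → Subset n → ℚ
    term A x = ⟦ w A ⟧ * (⟦ A ⊆ᵇ x ⟧ * (probD q p x y * φ ∣ x ∣))
    split : ∀ A x → (probD q p x y * φ ∣ x ∣) * ⟦ isKSubset k x A ∧ G A ⟧ ≡ term A x
    split A x = trans (cong ((probD q p x y * φ ∣ x ∣) *_)
                            (trans (cong ⟦_⟧ (∧-assoc (A ⊆ᵇ x) (∣ A ∣ ≡ᵇ k) (G A))) (⟦∧⟧ (A ⊆ᵇ x) (w A))))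
      (solve 3 (λ r i v → r :* (i :* v) := v :* (i :* r)) refl (probD q p x y * φ ∣ x ∣) ⟦ A ⊆ᵇ x ⟧ ⟦ w A ⟧)
    expand : ∀ x → probD q p x y * (kCount k G x * φ ∣ x ∣) ≡ Σₛ λ A → term A x
    expand x = trans (solve 3 (λ P N f → P :* (N :* f) := (P :* f) :* N) refl (probD q p x y) (kCount k G x) (φ ∣ x ∣))
      (trans (sym (sumOver-*ˡ (probD q p x y * φ ∣ x ∣) (λ A → ⟦ isKSubset k x A ∧ G A ⟧) (allSubsets n)))
        (sumOver-cong (λ A → split A x) (allSubsets n)))

  rowSum-cons : (a : Bool) (x : Subset n) →
    Σₛ (probD q p (a ∷ x)) ≡ (coordProb q p a true + coordProb q p a false) * Σₛ (probD q p x)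
  rowSum-cons {n} a x = trans (Σₛ-cons (probD q p (a ∷ x)))
    (trans (cong₂ _+_ (sumOver-*ˡ (coordProb q p a true) (probD q p x) (allSubsets n))
                      (sumOver-*ˡ (coordProb q p a false) (probD q p x) (allSubsets n)))
      (sym (*-distribʳ-+ (Σₛ (probD q p x)) (coordProb q p a true) (coordProb q p a false))))

  probY : Subset n → ℚ
  probY y = Σₛ λ x → probD q p x y

  probD-total : (n : ℕ) → Σₛ {n} (λ x → Σₛ (probD q p x)) ≡ 1ℚ
  probD-total zero    = refl
  probD-total (suc n) = begin
    Σₛ {suc n} (λ x → Σₛ (probD q p x))
      ≡⟨ Σₛ-cons {n} (λ x → Σₛ (probD q p x)) ⟩
    Σₛ {n} (λ x → Σₛ (probD q p (true ∷ x))) + Σₛ {n} (λ x → Σₛ (probD q p (false ∷ x)))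
      ≡⟨ cong₂ _+_ (half true) (half false) ⟩
    (q + 0ℚ) * 1ℚ + ((p - q) + (1ℚ - p)) * 1ℚ
      ≡⟨ solve 2 (λ q p → (q :+ con 0ℚ) :* con 1ℚ :+ ((p :- q) :+ (con 1ℚ :- p)) :* con 1ℚ := con 1ℚ) refl q p ⟩
    1ℚ ∎
    where
    open ≡-Reasoning
    half : (a : Bool) →
      Σₛ {n} (λ x → Σₛ (probD q p (a ∷ x))) ≡ (coordProb q p a true + coordProb q p a false) * 1ℚ
    half a = trans (sumOver-cong (rowSum-cons a) (allSubsets n))
      (trans (sumOver-*ˡ c (λ x → Σₛ (probD q p x)) (allSubsets n)) (cong (c *_) (probD-total n)))
      where
      c : ℚ
      c = coordProb q p a true + coordProb q p a false

  probY-total : (n : ℕ) → Σₛ {n} probY ≡ 1ℚ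
  probY-total n = trans (sym (sumOver-comm (probD q p) (allSubsets n) (allSubsets n))) (probD-total n)

module _ {q p : ℚ} (0≤q : 0ℚ ≤ q) (q≤p : q ≤ p) (p≤1 : p ≤ 1ℚ) where

  coordProb-nonneg : (a b : Bool) → 0ℚ ≤ coordProb q p a b
  coordProb-nonneg true  true  = 0≤q
  coordProb-nonneg true  false = ≤-refl
  coordProb-nonneg false true  = p≤q⇒0≤q-p q≤p
  coordProb-nonneg false false = p≤q⇒0≤q-p p≤1

  probD-nonneg : (x y : Subset n) → 0ℚ ≤ probD q p x y
  probD-nonneg []      []      = ≤ᵇ⇒≤ _
  probD-nonneg (a ∷ x) (b ∷ y) = *-nonneg (coordProb-nonneg a b) (probD-nonneg x y)

  probY-nonneg : (y : Subset n) → 0ℚ ≤ probY q p y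
  probY-nonneg {n} y = sumOver-nonneg (λ x → probD-nonneg x y) (allSubsets n)

  conditional-fF≤ : (k : ℕ) (F : Subset n → Bool) (y : Subset n) →
    Σₛ (λ x → probD q p x y * fF k F x) ≤ probY q p y * fF k F y
  conditional-fF≤ {n} k F y = begin
    Σₛ (λ x → probD q p x y * fF k F x)
      ≡⟨ sumOver-cong (λ x → cong (probD q p x y *_) (fF-as-kCount k F x)) (allSubsets n) ⟩
    Σₛ (λ x → probD q p x y * (kCount k F x * ψ ∣ x ∣))
      ≡⟨ kCount-doubleCount q p k F y ψ ⟩
    kCount k F y * c
      ≤⟨ proportional-≤ (∣ y ∣ C k) (kCount-nonneg k F y) (kCount≤binomial k F y) binomial*c≤probY ⟩
    probY q p y * (kCount k F y * ψ ∣ y ∣)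
      ≡⟨ cong (probY q p y *_) (fF-as-kCount k F y) ⟨
    probY q p y * fF k F y ∎
    where
    open ≤-Reasoning
    ψ : ℕ → ℚ
    ψ j = divℕ 1 (j C k)
    c : ℚ
    c = closedForm q p y k (∣ y ∣ ∸ k) ψ
    fAll≤1 : (x : Subset n) → kCount k (λ _ → true) x * ψ ∣ x ∣ ≤ 1ℚ
    fAll≤1 x = subst (_≤ 1ℚ) (cong (_* ψ ∣ x ∣) (sym (kCount-all k x))) (×-divℕ≤1 (∣ x ∣ C k))
    binomial*c≤probY : ((∣ y ∣ C k) × 1ℚ) * c ≤ probY q p y
    binomial*c≤probY = begin
      ((∣ y ∣ C k) × 1ℚ) * c
        ≡⟨ cong (_* c) (kCount-all k y) ⟨
      kCount k (λ _ → true) y * c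
        ≡⟨ kCount-doubleCount q p k (λ _ → true) y ψ ⟨
      Σₛ (λ x → probD q p x y * (kCount k (λ _ → true) x * ψ ∣ x ∣))
        ≤⟨ sumOver-mono (λ x → *-monoˡ-≤-nonneg (probD-nonneg x y) (fAll≤1 x)) (allSubsets n) ⟩
      Σₛ (λ x → probD q p x y * 1ℚ)
        ≡⟨ sumOver-cong (λ x → *-identityʳ (probD q p x y)) (allSubsets n) ⟩
      probY q p y ∎

expectD-by-y : (n : ℕ) (q p : ℚ) (h : Subset n → Subset n → ℚ) →
  expectD n q p h ≡ Σₛ (λ y → Σₛ λ x → probD q p x y * h x y)
expectD-by-y n q p h =
  trans (sumℚ-concatMap (λ x → map (λ y → probD q p x y * h x y) (allSubsets n)) (allSubsets n))
    (sumOver-comm (λ x y → probD q p x y * h x y) (allSubsets n) (allSubsets n))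

1-Cut-bound : {δ K P : ℚ} (g : Subset n → ℚ) (y : Subset n) →
  0ℚ ≤ δ → 0ℚ ≤ P → K ≤ P * g y → (1ℚ - Cut δ g y) * K ≤ δ * P
1-Cut-bound {δ = δ} {K} {P} g y 0≤δ 0≤P K≤Pg with δ ≤ᵇ g y in δ≤ᵇg
... | true  = ≤-trans (≤-reflexive (*-zeroˡ K)) (*-nonneg 0≤δ 0≤P)
... | false = begin
  1ℚ * K   ≡⟨ *-identityˡ K ⟩
  K        ≤⟨ K≤Pg ⟩
  P * g y  ≤⟨ *-monoˡ-≤-nonneg 0≤P g≤δ ⟩
  P * δ    ≡⟨ *-comm P δ ⟩
  δ * P    ∎
  where
  open ≤-Reasoning
  g≤δ : g y ≤ δ
  g≤δ = <⇒≤ (≰⇒> (λ δ≤g → subst T δ≤ᵇg (≤⇒≤ᵇ δ≤g)))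

lemma6p10 : (n k : ℕ) (δ p q : ℚ) → 0ℚ < δ → 0ℚ < q → q < p → p < 1ℚ →
    (+ k) / 1 < q * ((+ n) / 1) →
    (F : Subset n → Bool) → IsKFamily n k F →
    expectD n q p (λ x y → fF k F x * (1ℚ - Cut δ (fF k F) y)) ≤ δ
lemma6p10 n k δ p q 0<δ 0<q q<p p<1 _ F _ = begin
  expectD n q p (λ x y → f x * (1ℚ - Cut δ f y))
    ≡⟨ expectD-by-y n q p (λ x y → f x * (1ℚ - Cut δ f y)) ⟩
  Σₛ (λ y → Σₛ λ x → probD q p x y * (f x * (1ℚ - Cut δ f y)))
    ≡⟨ sumOver-cong pullOutCut (allSubsets n) ⟩
  Σₛ (λ y → (1ℚ - Cut δ f y) * Σₛ (λ x → probD q p x y * f x))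
    ≤⟨ sumOver-mono uncutMass≤ (allSubsets n) ⟩
  Σₛ {n} (λ y → δ * probY q p y)
    ≡⟨ sumOver-*ˡ δ (probY q p) (allSubsets n) ⟩
  δ * Σₛ {n} (probY q p)
    ≡⟨ cong (δ *_) (probY-total q p n) ⟩
  δ * 1ℚ
    ≡⟨ *-identityʳ δ ⟩
  δ ∎
  where
  open ≤-Reasoning
  f : Subset n → ℚ
  f = fF k F
  0≤q : 0ℚ ≤ q
  0≤q = <⇒≤ 0<q
  q≤p : q ≤ p
  q≤p = <⇒≤ q<p
  p≤1 : p ≤ 1ℚ
  p≤1 = <⇒≤ p<1
  pullOutCut : ∀ y → Σₛ (λ x → probD q p x y * (f x * (1ℚ - Cut δ f y))) ≡
                     (1ℚ - Cut δ f y) * Σₛ (λ x → probD q p x y * f x)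
  pullOutCut y = trans
    (sumOver-cong (λ x → solve 3 (λ P v c → P :* (v :* c) := c :* (P :* v)) refl (probD q p x y) (f x) (1ℚ - Cut δ f y))
                  (allSubsets n))
    (sumOver-*ˡ (1ℚ - Cut δ f y) (λ x → probD q p x y * f x) (allSubsets n))
  uncutMass≤ : ∀ y → (1ℚ - Cut δ f y) * Σₛ (λ x → probD q p x y * f x) ≤ δ * probY q p y
  uncutMass≤ y = 1-Cut-bound f y (<⇒≤ 0<δ) (probY-nonneg 0≤q q≤p p≤1 y) (conditional-fF≤ 0≤q q≤p p≤1 k F y)
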